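{- Let $R$ be a discrete valuation ring with uniformizer $\pi$ and finite residue field of prime characteristic $p$, and let $n,k\geq 1$ be integers. For $a \in R^\times$ and $y_1, y_2 \in \pi^c R$ we have \[ (a+y_1+y_2) ^{1-k} - (a+y_1)^{1-k} - (a+y_2)^{1-k} + a^{1-k} \equiv 0 \bmod \pi^n .\]
   Context: $R$ is either of characteristic $0$ or of characteristic $p$. Let $v$ be the $p$-adic valuation of $k$ and $\mathbb N=\{0,1,2,\dots\}$. Define $c= \min \{ s \in \mathbb N : \pi^{ (p^r+ 1) s } p ^{ v-r} \equiv 0 \bmod \pi^{n} \text{ in } R \text{ for all } r \in \mathbb N, r\leq v \}$. -}

module Defs where

open import Level using (_⊔_)
open import Algebra.Bundles using (CommutativeRing)
open import Data.Nat as ℕ using (ℕ; zero; suc; _≤_; _∸_)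
open import Data.Nat.Divisibility as ℕD using ()
open import Data.Nat.Primality using (Prime)
open import Data.Product using (∃; _×_; Σ)
open import Data.List using (List)
open import Data.List.Relation.Unary.Any using (Any)
open import Relation.Nullary using (¬_)

IsPadicVal : ℕ → ℕ → ℕ → Set
IsPadicVal p k v = (p ℕ.^ v) ℕD.∣ k × ¬ ((p ℕ.^ suc v) ℕD.∣ k)

module _ {c ℓ} (R : CommutativeRing c ℓ) where
  open CommutativeRing R

  pow : Carrier → ℕ → Carrier
  pow x zero = 1#
  pow x (suc n) = x * pow x n

  fromℕ : ℕ → Carrier
  fromℕ zero = 0#
  fromℕ (suc n) = 1# + fromℕ n

  _∣R_ : Carrier → Carrier → Set (c ⊔ ℓ)
  x ∣R y = ∃ λ q → y ≈ x * q

  _≡_mod_ : Carrier → Carrier → Carrier → Set (c ⊔ ℓ)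
  x ≡ y mod m = m ∣R (x - y)

  record IsDVR (π : Carrier) : Set (c ⊔ ℓ) where
    field
      nontrivial : ¬ (1# ≈ 0#)
      domain     : ∀ x y → x * y ≈ 0# → ¬ (x ≈ 0#) → y ≈ 0#
      π≉0        : ¬ (π ≈ 0#)
      π-nonunit  : ¬ (∃ λ u → π * u ≈ 1#)
      factor     : ∀ x → ¬ (x ≈ 0#) →
                   Σ ℕ λ m → ∃ λ u → (∃ λ w → u * w ≈ 1#) × x ≈ u * pow π m

  FiniteResidueField : Carrier → Set (c ⊔ ℓ)
  FiniteResidueField π = ∃ λ (L : List Carrier) → ∀ x → Any (λ y → π ∣R (x - y)) L

  ResidueChar : Carrier → ℕ → Set (c ⊔ ℓ)
  ResidueChar π p = Prime p × π ∣R fromℕ p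

  -- the defining property of c (minus minimality):
  -- π^((p^r+1)s) p^(v-r) ≡ 0 mod π^n for all r ≤ v
  CProp : Carrier → ℕ → ℕ → ℕ → ℕ → Set (c ⊔ ℓ)
  CProp π p n v s = ∀ r → r ≤ v →
    (pow π ((p ℕ.^ r ℕ.+ 1) ℕ.* s) * fromℕ (p ℕ.^ (v ∸ r))) ≡ 0# mod pow π n

  IsC : Carrier → ℕ → ℕ → ℕ → ℕ → Set (c ⊔ ℓ)
  IsC π p n v s = CProp π p n v s × (∀ s′ → CProp π p n v s′ → s ≤ s′)

module Submission where

-- Multiplying by a, a + y₁, a + y₂, a + y₁ + y₂ turns the powers b^(k−1) of the inverses into b^k,
-- and b₁ = b₀(1 + δ₁), b₂ = b₀(1 + δ₂), b₁₂ = b₀(1 + δ₁)(1 + δ₂)(1 + δ₃) with δ₁, δ₂ ∈ π^s R and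
-- δ₃ = y₁y₂b₀b₁₂ ∈ π^(2s) R. With Pᵢ = (1 + δᵢ)^k − 1 the second difference becomes
-- b₀^k (a P₁P₂ + (a + y₁ + y₂)(1 + P₁)(1 + P₂)P₃ + (1 + P₁) y₁P₂ + (1 + P₂) y₂P₁),
-- so everything reduces to bounding x((1 + δ)^k − 1) for x, δ ∈ π^s R and (1 + δ)^k − 1 for δ ∈ π^(2s) R.
-- Writing k = q p^v, (1 + δ)^k − 1 is a multiple of (1 + δ)^(p^v) − 1, and by induction on j,
-- (1 + δ)^(p^j) − 1 lies in the ideal I_j generated by π^(p^r t) p^(j−r), r ≤ j, whenever δ ∈ π^t R:
-- (1 + ε)^p − 1 ∈ pεR + ε^p R, and pI_j ⊆ I_(j+1), ε^(p−1) I_j ⊆ I_(j+1).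
-- The defining property of c says that π^n divides π^s I_v (for t = s) and I_v (for t = 2s).

open import Defs
open import Algebra.Bundles using (CommutativeRing)
import Algebra.Solver.Ring.AlmostCommutativeRing as ACR
open import Data.Empty using (⊥-elim)
open import Data.Fin using (zero; suc)
open import Data.Fin.Properties using (toℕ-fromℕ; inject₁ℕ<)
open import Data.Integer as ℤ using (ℤ)
import Data.Integer.Properties as ℤ
open import Data.Maybe using (Maybe; just; nothing)
open import Data.Nat as ℕ using (ℕ; zero; suc; _≤_; _<_; _≥_; _∸_; s≤s; z≤n; pred; NonZero)
open import Data.Nat.Combinatorics using (_C_; nC1≡n; nCn≡1; nCk+nC[k+1]≡[n+1]C[k+1])
open import Data.Nat.Divisibility using (divides; ∣⇒≤) renaming (_∣_ to _∣ℕ_)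
open import Data.Nat.Primality using (Prime; euclidsLemma; prime⇒nonZero)
import Data.Nat.Properties as ℕₚ
open import Data.Nat.Tactic.RingSolver using (solve-∀)
open import Data.Product using (∃; _,_)
open import Data.Sign as Sign using (Sign)
open import Data.Sum using (inj₁; inj₂)
open import Data.Vec.Functional using (Vector; tail; init; last)
open import Function using (_∘_)
open import Level using (_⊔_)
open import Relation.Binary.PropositionalEquality as ≡ using (_≡_)
open import Relation.Nullary using (yes; no)
open import Relation.Unary using (Pred)

[1+k]*[1+n]C[1+k]≡[1+n]*nCk : ∀ n k → suc k ℕ.* (suc n C suc k) ≡ suc n ℕ.* (n C k)
[1+k]*[1+n]C[1+k]≡[1+n]*nCk zero    zero    = ≡.refl
[1+k]*[1+n]C[1+k]≡[1+n]*nCk zero    (suc k) = ℕₚ.*-zeroʳ (suc (suc k))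
[1+k]*[1+n]C[1+k]≡[1+n]*nCk (suc n) zero    = begin
  1 ℕ.* (suc (suc n) C 1)  ≡⟨ ℕₚ.*-identityˡ _ ⟩
  suc (suc n) C 1          ≡⟨ nC1≡n (suc (suc n)) ⟩
  suc (suc n)              ≡⟨ ℕₚ.*-identityʳ (suc (suc n)) ⟨
  suc (suc n) ℕ.* 1        ∎
  where open ≡.≡-Reasoning
[1+k]*[1+n]C[1+k]≡[1+n]*nCk (suc n) (suc k) = begin
  suc (suc k) ℕ.* (suc (suc n) C suc (suc k))
    ≡⟨ ≡.cong (suc (suc k) ℕ.*_) (nCk+nC[k+1]≡[n+1]C[k+1] (suc n) (suc k)) ⟨
  suc (suc k) ℕ.* (X ℕ.+ Y)
    ≡⟨ ℕₚ.*-distribˡ-+ (suc (suc k)) X Y ⟩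
  (X ℕ.+ suc k ℕ.* X) ℕ.+ suc (suc k) ℕ.* Y
    ≡⟨ ≡.cong₂ (λ u w → (X ℕ.+ u) ℕ.+ w) ([1+k]*[1+n]C[1+k]≡[1+n]*nCk n k)
                                          ([1+k]*[1+n]C[1+k]≡[1+n]*nCk n (suc k)) ⟩
  (X ℕ.+ suc n ℕ.* (n C k)) ℕ.+ suc n ℕ.* (n C suc k)
    ≡⟨ ℕₚ.+-assoc X _ _ ⟩
  X ℕ.+ (suc n ℕ.* (n C k) ℕ.+ suc n ℕ.* (n C suc k))
    ≡⟨ ≡.cong (X ℕ.+_) (ℕₚ.*-distribˡ-+ (suc n) (n C k) (n C suc k)) ⟨
  X ℕ.+ suc n ℕ.* (n C k ℕ.+ n C suc k)
    ≡⟨ ≡.cong (λ u → X ℕ.+ suc n ℕ.* u) (nCk+nC[k+1]≡[n+1]C[k+1] n k) ⟩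
  suc (suc n) ℕ.* X ∎
  where
  open ≡.≡-Reasoning
  X = suc n C suc k
  Y = suc n C suc (suc k)

p∣pCk : ∀ {p k} → Prime p → 0 < k → k < p → p ∣ℕ p C k
p∣pCk {suc n} {suc i} p-prime _ k<p
  with euclidsLemma (suc i) (suc n C suc i) p-prime
         (divides (n C i) (≡.trans ([1+k]*[1+n]C[1+k]≡[1+n]*nCk n i) (ℕₚ.*-comm (suc n) (n C i))))
... | inj₁ p∣k = ⊥-elim (ℕₚ.<⇒≱ k<p (∣⇒≤ p∣k))
... | inj₂ p∣C = p∣C

[m+1]*n≡n+m*n : ∀ m n → (m ℕ.+ 1) ℕ.* n ≡ n ℕ.+ m ℕ.* n
[m+1]*n≡n+m*n = solve-∀

[m+1]*n≤m*[n+n] : ∀ m n .{{_ : NonZero m}} → (m ℕ.+ 1) ℕ.* n ≤ m ℕ.* (n ℕ.+ n)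
[m+1]*n≤m*[n+n] m n = begin
  (m ℕ.+ 1) ℕ.* n      ≡⟨ [m+1]*n≡n+m*n m n ⟩
  n ℕ.+ m ℕ.* n        ≤⟨ ℕₚ.+-monoˡ-≤ (m ℕ.* n) (ℕₚ.m≤n*m n m) ⟩
  m ℕ.* n ℕ.+ m ℕ.* n  ≡⟨ ℕₚ.*-distribˡ-+ m n n ⟨
  m ℕ.* (n ℕ.+ n)      ∎
  where open ℕₚ.≤-Reasoning

-- The ring solver needs a coefficient ring mapped into R; we use ℤ. The type-checking optimised
-- _×_ is used so that the coefficient 1 is interpreted as 1# itself.
module IntegerCoefficientSolver {c ℓ} (R : CommutativeRing c ℓ) where
  open CommutativeRing R
  open import Algebra.Properties.Ring ring
    using (-0#≈0#; -‿involutive; ⁻¹-anti-homo‿-; -‿+-comm; -1*x≈-x; -‿distribʳ-*)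
  open import Algebra.Properties.CommutativeSemigroup *-commutativeSemigroup using (interchange)
  open import Algebra.Properties.Semiring.Mult.TCOptimised semiring using (_×_; ×-homo-+; ×1-homo-*)
  open import Relation.Binary.Reasoning.Setoid setoid

  private
    fromℤ : ℤ → Carrier
    fromℤ (ℤ.+ n)    = n × 1#
    fromℤ ℤ.-[1+ n ] = - (suc n × 1#)

    fromSign : Sign → Carrier
    fromSign Sign.+ = 1#
    fromSign Sign.- = - 1#

    fromℤ-neg : ∀ i → fromℤ (ℤ.- i) ≈ - fromℤ i
    fromℤ-neg ℤ.-[1+ n ]  = sym (-‿involutive _)
    fromℤ-neg (ℤ.+ zero)  = sym -0#≈0#
    fromℤ-neg (ℤ.+ suc n) = refl

    fromℤ-⊖-≥ : ∀ {m n} → n ≤ m → fromℤ (m ℤ.⊖ n) ≈ m × 1# - n × 1#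
    fromℤ-⊖-≥ {m} {n} n≤m = begin
      fromℤ (m ℤ.⊖ n)                      ≡⟨ ≡.cong fromℤ (ℤ.⊖-≥ n≤m) ⟩
      (m ∸ n) × 1#                         ≈⟨ +-identityʳ _ ⟨
      (m ∸ n) × 1# + 0#                    ≈⟨ +-congˡ (-‿inverseʳ (n × 1#)) ⟨
      (m ∸ n) × 1# + (n × 1# - n × 1#)     ≈⟨ +-assoc _ _ _ ⟨
      (m ∸ n) × 1# + n × 1# - n × 1#       ≈⟨ +-congʳ (×-homo-+ 1# (m ∸ n) n) ⟨
      (m ∸ n ℕ.+ n) × 1# - n × 1#          ≡⟨ ≡.cong (λ l → l × 1# - n × 1#) (ℕₚ.m∸n+n≡m n≤m) ⟩
      m × 1# - n × 1#                      ∎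

    fromℤ-⊖ : ∀ m n → fromℤ (m ℤ.⊖ n) ≈ m × 1# - n × 1#
    fromℤ-⊖ m n with ℕₚ.≤-<-connex n m
    ... | inj₁ n≤m = fromℤ-⊖-≥ n≤m
    ... | inj₂ m<n = begin
      fromℤ (m ℤ.⊖ n)          ≡⟨ ≡.cong fromℤ (ℤ.⊖-swap m n) ⟩
      fromℤ (ℤ.- (n ℤ.⊖ m))    ≈⟨ fromℤ-neg (n ℤ.⊖ m) ⟩
      - fromℤ (n ℤ.⊖ m)        ≈⟨ -‿cong (fromℤ-⊖-≥ (ℕₚ.<⇒≤ m<n)) ⟩
      - (n × 1# - m × 1#)      ≈⟨ ⁻¹-anti-homo‿- _ _ ⟩
      m × 1# - n × 1#          ∎

    fromℤ-+ : ∀ i j → fromℤ (i ℤ.+ j) ≈ fromℤ i + fromℤ j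
    fromℤ-+ (ℤ.+ m)    (ℤ.+ n)    = ×-homo-+ 1# m n
    fromℤ-+ (ℤ.+ m)    ℤ.-[1+ n ] = fromℤ-⊖ m (suc n)
    fromℤ-+ ℤ.-[1+ m ] (ℤ.+ n)    = trans (fromℤ-⊖ n (suc m)) (+-comm _ _)
    fromℤ-+ ℤ.-[1+ m ] ℤ.-[1+ n ] = begin
      - (suc (suc (m ℕ.+ n)) × 1#)      ≡⟨ ≡.cong (λ l → - (suc l × 1#)) (ℕₚ.+-suc m n) ⟨
      - ((suc m ℕ.+ suc n) × 1#)        ≈⟨ -‿cong (×-homo-+ 1# (suc m) (suc n)) ⟩
      - (suc m × 1# + suc n × 1#)       ≈⟨ -‿+-comm _ _ ⟨
      - (suc m × 1#) + - (suc n × 1#)   ∎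

    fromSign-* : ∀ s t → fromSign (s Sign.* t) ≈ fromSign s * fromSign t
    fromSign-* Sign.+ t      = sym (*-identityˡ _)
    fromSign-* Sign.- Sign.+ = sym (*-identityʳ _)
    fromSign-* Sign.- Sign.- = begin
      1#             ≈⟨ -‿involutive 1# ⟨
      - - 1#         ≈⟨ -‿cong (-1*x≈-x 1#) ⟨
      - (- 1# * 1#)  ≈⟨ -‿distribʳ-* (- 1#) 1# ⟩
      - 1# * - 1#    ∎

    fromℤ-◃ : ∀ s n → fromℤ (s ℤ.◃ n) ≈ fromSign s * n × 1#
    fromℤ-◃ Sign.+ n = trans (reflexive (≡.cong fromℤ (ℤ.+◃n≡+n n))) (sym (*-identityˡ _))
    fromℤ-◃ Sign.- n = trans (reflexive (≡.cong fromℤ (ℤ.-◃n≡-n n))) (trans (fromℤ-neg (ℤ.+ n)) (sym (-1*x≈-x _)))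

    fromℤ-sign◃abs : ∀ i → fromSign (ℤ.sign i) * ℤ.∣ i ∣ × 1# ≈ fromℤ i
    fromℤ-sign◃abs i = trans (sym (fromℤ-◃ (ℤ.sign i) ℤ.∣ i ∣)) (reflexive (≡.cong fromℤ (ℤ.◃-inverse i)))

    fromℤ-* : ∀ i j → fromℤ (i ℤ.* j) ≈ fromℤ i * fromℤ j
    fromℤ-* i j = begin
      fromℤ (i ℤ.* j)
        ≈⟨ fromℤ-◃ (sᵢ Sign.* sⱼ) (ℤ.∣ i ∣ ℕ.* ℤ.∣ j ∣) ⟩
      fromSign (sᵢ Sign.* sⱼ) * (ℤ.∣ i ∣ ℕ.* ℤ.∣ j ∣) × 1#
        ≈⟨ *-cong (fromSign-* sᵢ sⱼ) (×1-homo-* ℤ.∣ i ∣ ℤ.∣ j ∣) ⟩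
      fromSign sᵢ * fromSign sⱼ * (ℤ.∣ i ∣ × 1# * ℤ.∣ j ∣ × 1#)
        ≈⟨ interchange _ _ _ _ ⟩
      fromSign sᵢ * ℤ.∣ i ∣ × 1# * (fromSign sⱼ * ℤ.∣ j ∣ × 1#)
        ≈⟨ *-cong (fromℤ-sign◃abs i) (fromℤ-sign◃abs j) ⟩
      fromℤ i * fromℤ j
        ∎
      where
      sᵢ = ℤ.sign i
      sⱼ = ℤ.sign j

    homomorphism : ℤ.+-*-rawRing ACR.-Raw-AlmostCommutative⟶ ACR.fromCommutativeRing R
    homomorphism = record
      { ⟦_⟧ = fromℤ ; +-homo = fromℤ-+ ; *-homo = fromℤ-* ; -‿homo = fromℤ-neg ; 0-homo = refl ; 1-homo = refl }

    coefficient≟ : ∀ i j → Maybe (fromℤ i ≈ fromℤ j)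
    coefficient≟ i j with i ℤ.≟ j
    ... | yes ≡.refl = just refl
    ... | no _       = nothing

  open import Algebra.Solver.Ring ℤ.+-*-rawRing (ACR.fromCommutativeRing R) homomorphism coefficient≟ public

  :0 :1 : ∀ {n} → Polynomial n
  :0 = con (ℤ.+ 0)
  :1 = con (ℤ.+ 1)

module _ {c ℓ} (R : CommutativeRing c ℓ) where
  open CommutativeRing R hiding (zero)
  open IntegerCoefficientSolver R using (solve; _:+_; _:*_; _:-_; :-_; _:=_; :0; :1)
  open import Algebra.Properties.Ring ring using (-0#≈0#)
  open import Algebra.Properties.CommutativeSemiring.Exp commutativeSemiring
    using (_^_; ^-congˡ; ^-congʳ; ^-homo-*; ^-assocʳ; ^-distrib-*)
  open import Algebra.Properties.Semiring.Mult semiring using (_×_; ×1-homo-*; ×-assoc-*; ×-congʳ)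
  open import Algebra.Properties.Semiring.Sum semiring using (sum; sum-init-last)
  open import Algebra.Properties.CommutativeSemiring.Binomial commutativeSemiring using (theorem; binomialTerm)
  open import Relation.Binary.Reasoning.Setoid setoid

  infix 4 _∣_
  _∣_ : Carrier → Carrier → Set (c ⊔ ℓ)
  _∣_ = _∣R_ R

  ∣-respʳ : ∀ {d x y} → x ≈ y → d ∣ x → d ∣ y
  ∣-respʳ x≈y (q , x≈dq) = q , trans (sym x≈y) x≈dq

  ∣-respˡ : ∀ {d e x} → d ≈ e → d ∣ x → e ∣ x
  ∣-respˡ d≈e (q , x≈dq) = q , trans x≈dq (*-congʳ d≈e)

  ∣-refl : ∀ {d} → d ∣ d
  ∣-refl = 1# , sym (*-identityʳ _)

  ∣-trans : ∀ {d x y} → d ∣ x → x ∣ y → d ∣ y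
  ∣-trans {d} (q , x≈dq) (q′ , y≈xq′) = q * q′ , trans y≈xq′ (trans (*-congʳ x≈dq) (*-assoc d q q′))

  ∣-+ : ∀ {d x y} → d ∣ x → d ∣ y → d ∣ x + y
  ∣-+ {d} (q , x≈dq) (q′ , y≈dq′) = q + q′ , trans (+-cong x≈dq y≈dq′) (sym (distribˡ d q q′))

  ∣-*ʳ : ∀ {d x} → d ∣ x → ∀ y → d ∣ x * y
  ∣-*ʳ {d} (q , x≈dq) y = q * y , trans (*-congʳ x≈dq) (*-assoc d q y)

  ∣-*ˡ : ∀ {d x} → d ∣ x → ∀ y → d ∣ y * x
  ∣-*ˡ d∣x y = ∣-respʳ (*-comm _ y) (∣-*ʳ d∣x y)

  ∣-*-cong : ∀ {a b x y} → a ∣ x → b ∣ y → a * b ∣ x * y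
  ∣-*-cong {a} {b} (q , x≈aq) (q′ , y≈bq′) = q * q′ , trans (*-cong x≈aq y≈bq′)
    (solve 4 (λ a q b q′ → a :* q :* (b :* q′) := a :* b :* (q :* q′)) refl a q b q′)

  ∣-sum : ∀ {d n} (t : Vector Carrier n) → (∀ i → d ∣ t i) → d ∣ sum t
  ∣-sum {d} {zero}  t _   = 0# , sym (zeroʳ d)
  ∣-sum {d} {suc n} t d∣t = ∣-+ (d∣t zero) (∣-sum (tail t) (d∣t ∘ suc))

  1^n≈1 : ∀ n → 1# ^ n ≈ 1#
  1^n≈1 zero    = refl
  1^n≈1 (suc n) = trans (*-identityˡ _) (1^n≈1 n)

  ^-∣-^ : ∀ x {m n} → m ≤ n → x ^ m ∣ x ^ n
  ^-∣-^ x {m} {n} m≤n = x ^ (n ∸ m) , (begin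
    x ^ n                 ≡⟨ ≡.cong (x ^_) (ℕₚ.m+[n∸m]≡n m≤n) ⟨
    x ^ (m ℕ.+ (n ∸ m))   ≈⟨ ^-homo-* x m (n ∸ m) ⟩
    x ^ m * x ^ (n ∸ m)   ∎)

  x-y∣xⁿ-yⁿ : ∀ x y n → x - y ∣ x ^ n - y ^ n
  x-y∣xⁿ-yⁿ x y zero    = 0# , solve 1 (λ z → :1 :- :1 := z :* :0) refl (x - y)
  x-y∣xⁿ-yⁿ x y (suc n) = ∣-respʳ
    (solve 4 (λ x y X Y → x :* (X :- Y) :+ Y :* (x :- y) := x :* X :- y :* Y) refl x y (x ^ n) (y ^ n))
    (∣-+ (∣-*ˡ (x-y∣xⁿ-yⁿ x y n) x) (∣-*ˡ ∣-refl (y ^ n)))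

  δ∣[1+δ]ⁿ-1 : ∀ δ n → δ ∣ (1# + δ) ^ n - 1#
  δ∣[1+δ]ⁿ-1 δ n = ∣-respʳ (+-congˡ (-‿cong (1^n≈1 n)))
    (∣-trans (1# , solve 1 (λ δ → :1 :+ δ :- :1 := δ :* :1) refl δ) (x-y∣xⁿ-yⁿ (1# + δ) 1# n))

  n×x≈n×1#*x : ∀ n x → n × x ≈ n × 1# * x
  n×x≈n×1#*x n x = trans (×-congʳ n (sym (*-identityˡ x))) (sym (×-assoc-* n 1# x))

  ×1#-homo-^ : ∀ m n → (m ℕ.^ n) × 1# ≈ (m × 1#) ^ n
  ×1#-homo-^ m zero    = +-identityʳ 1#
  ×1#-homo-^ m (suc n) = trans (×1-homo-* m (m ℕ.^ n)) (*-congˡ (×1#-homo-^ m n))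

  p*x∣[1+x]ᵖ-1-xᵖ : ∀ {p} → Prime p → ∀ x → p × 1# * x ∣ (1# + x) ^ p - 1# - x ^ p
  p*x∣[1+x]ᵖ-1-xᵖ {suc p′} p-prime x = ∣-respʳ S≈ (∣-sum (init (tail T)) (λ i → middle-term (inject₁ℕ< i)))
    where
    p = suc p′
    T = binomialTerm x 1# p
    S = sum (init (tail T))

    middle-term : ∀ {m} → m < p′ → p × 1# * x ∣ (p C suc m) × (x ^ suc m * 1# ^ (p′ ∸ m))
    middle-term {m} m<p′ with p∣pCk p-prime (s≤s z≤n) (s≤s m<p′)
    ... | divides d C≡d*p = d × 1# * (x ^ m * O) , (begin
      (p C suc m) × (x * x ^ m * O)        ≡⟨ ≡.cong (_× (x * x ^ m * O)) C≡d*p ⟩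
      (d ℕ.* p) × (x * x ^ m * O)          ≈⟨ n×x≈n×1#*x (d ℕ.* p) (x * x ^ m * O) ⟩
      (d ℕ.* p) × 1# * (x * x ^ m * O)     ≈⟨ *-congʳ (×1-homo-* d p) ⟩
      d × 1# * p × 1# * (x * x ^ m * O)
        ≈⟨ solve 5 (λ D P x X O → D :* P :* (x :* X :* O) := P :* x :* (D :* (X :* O)))
             refl (d × 1#) (p × 1#) x (x ^ m) O ⟩
      p × 1# * x * (d × 1# * (x ^ m * O))  ∎)
      where O = 1# ^ (p′ ∸ m)

    first-term : T zero ≈ 1#
    first-term = trans (+-identityʳ _) (trans (*-identityˡ _) (1^n≈1 p))

    last-term : last (tail T) ≈ x ^ p
    last-term = begin
      last (tail T)                        ≡⟨ ≡.cong term (toℕ-fromℕ p′) ⟩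
      (p C p) × (x ^ p * 1# ^ (p′ ∸ p′))   ≡⟨ ≡.cong (_× (x ^ p * 1# ^ (p′ ∸ p′))) (nCn≡1 p) ⟩
      1 × (x ^ p * 1# ^ (p′ ∸ p′))         ≈⟨ +-identityʳ _ ⟩
      x ^ p * 1# ^ (p′ ∸ p′)               ≈⟨ *-congˡ (1^n≈1 (p′ ∸ p′)) ⟩
      x ^ p * 1#                           ≈⟨ *-identityʳ _ ⟩
      x ^ p                                ∎
      where
      term : ℕ → Carrier
      term j = (p C suc j) × (x ^ suc j * 1# ^ (p′ ∸ j))

    S≈ : S ≈ (1# + x) ^ p - 1# - x ^ p
    S≈ = begin
      S                                          ≈⟨ solve 3 (λ S O X → S := O :+ (S :+ X) :- O :- X) refl S 1# (x ^ p) ⟩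
      1# + (S + x ^ p) - 1# - x ^ p              ≈⟨ +-congʳ (+-congʳ (+-cong first-term (+-congˡ last-term))) ⟨
      T zero + (S + last (tail T)) - 1# - x ^ p  ≈⟨ +-congʳ (+-congʳ (+-congˡ (sum-init-last (tail T)))) ⟨
      sum T - 1# - x ^ p                         ≈⟨ +-congʳ (+-congʳ (theorem p x 1#)) ⟨
      (x + 1#) ^ p - 1# - x ^ p                  ≈⟨ +-congʳ (+-congʳ (^-congˡ p (+-comm x 1#))) ⟩
      (1# + x) ^ p - 1# - x ^ p                  ∎

  -- Ideals

  record IsIdeal {ℓ′} (I : Pred Carrier ℓ′) : Set (c ⊔ ℓ ⊔ ℓ′) where
    field
      ∈-resp-≈ : ∀ {x y} → x ≈ y → I x → I y
      +-closed : ∀ {x y} → I x → I y → I (x + y)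
      *-closed : ∀ {x} y → I x → I (x * y)

  ∣-isIdeal : ∀ d → IsIdeal (d ∣_)
  ∣-isIdeal d = record { ∈-resp-≈ = ∣-respʳ ; +-closed = ∣-+ ; *-closed = λ y d∣x → ∣-*ʳ d∣x y }

  *-preimage-isIdeal : ∀ {ℓ′} {I : Pred Carrier ℓ′} w → IsIdeal I → IsIdeal (λ x → I (w * x))
  *-preimage-isIdeal w isIdeal = record
    { ∈-resp-≈ = λ x≈y → ∈-resp-≈ (*-congˡ x≈y)
    ; +-closed = λ wx∈I wy∈I → ∈-resp-≈ (sym (distribˡ w _ _)) (+-closed wx∈I wy∈I)
    ; *-closed = λ y wx∈I → ∈-resp-≈ (*-assoc w _ y) (*-closed y wx∈I)
    }
    where open IsIdeal isIdeal

  data Span (g : ℕ → Carrier) (j : ℕ) : Pred Carrier (c ⊔ ℓ) where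
    multiple : ∀ {r} → r ≤ j → ∀ y → Span g j (g r * y)
    add      : ∀ {x y} → Span g j x → Span g j y → Span g j (x + y)
    resp     : ∀ {x y} → x ≈ y → Span g j x → Span g j y

  Span-isIdeal : ∀ {g j} → IsIdeal (Span g j)
  Span-isIdeal {g} {j} = record { ∈-resp-≈ = resp ; +-closed = add ; *-closed = *-closed }
    where
    *-closed : ∀ {x} y → Span g j x → Span g j (x * y)
    *-closed z (multiple r≤j y) = resp (sym (*-assoc _ y z)) (multiple r≤j (y * z))
    *-closed z (add x∈ y∈)      = resp (sym (distribʳ z _ _)) (add (*-closed z x∈) (*-closed z y∈))
    *-closed z (resp x≈y x∈)    = resp (*-congʳ x≈y) (*-closed z x∈)

  Span-generator : ∀ {g j r} → r ≤ j → Span g j (g r)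
  Span-generator r≤j = resp (*-identityʳ _) (multiple r≤j 1#)

  Span-least : ∀ {ℓ′} {I : Pred Carrier ℓ′} {g j} → IsIdeal I → (∀ {r} → r ≤ j → I (g r)) →
               ∀ {x} → Span g j x → I x
  Span-least {I = I} {g} {j} isIdeal g∈I = go
    where
    open IsIdeal isIdeal
    go : ∀ {x} → Span g j x → I x
    go (multiple r≤j y) = *-closed y (g∈I r≤j)
    go (add x∈ y∈)      = +-closed (go x∈) (go y∈)
    go (resp x≈y x∈)    = ∈-resp-≈ x≈y (go x∈)

  PairIdeal : Carrier → Carrier → Pred Carrier (c ⊔ ℓ)
  PairIdeal a b x = ∃ λ β → a ∣ x - b * β

  PairIdeal-isIdeal : ∀ {a b} → IsIdeal (PairIdeal a b)
  PairIdeal-isIdeal {a} {b} = record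
    { ∈-resp-≈ = λ x≈y (β , a∣x-bβ) → β , ∣-respʳ (+-congʳ x≈y) a∣x-bβ
    ; +-closed = λ {x} {y} (β , a∣x-bβ) (γ , a∣y-bγ) → β + γ , ∣-respʳ
        (solve 5 (λ x y b β γ → (x :- b :* β) :+ (y :- b :* γ) := x :+ y :- b :* (β :+ γ)) refl x y b β γ)
        (∣-+ a∣x-bβ a∣y-bγ)
    ; *-closed = λ {x} z (β , a∣x-bβ) → β * z , ∣-respʳ
        (solve 4 (λ x z b β → (x :- b :* β) :* z := x :* z :- b :* (β :* z)) refl x z b β)
        (∣-*ʳ a∣x-bβ z)
    }

  ∣⇒PairIdealˡ : ∀ {a b x} → a ∣ x → PairIdeal a b x
  ∣⇒PairIdealˡ {a} {b} {x} a∣x = 0# , ∣-respʳ (solve 2 (λ x b → x := x :- b :* :0) refl x b) a∣x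

  ∣⇒PairIdealʳ : ∀ {a b x} → b ∣ x → PairIdeal a b x
  ∣⇒PairIdealʳ {a} {b} (β , x≈bβ) =
    β , 0# , trans (+-congʳ x≈bβ) (solve 3 (λ a b β → b :* β :- b :* β := a :* :0) refl a b β)

  -- Powers of units 1 + δ with δ ∈ π^t R

  module PrimePowerLifting (π : Carrier) {p : ℕ} (p-prime : Prime p) (t : ℕ) where
    private
      instance
        p≢0 : NonZero p
        p≢0 = prime⇒nonZero p-prime

      P : Carrier
      P = p × 1#

    π-power : ℕ → Carrier
    π-power r = π ^ (p ℕ.^ r ℕ.* t)

    generator : ℕ → ℕ → Carrier
    generator j r = π-power r * P ^ (j ∸ r)

    I : ℕ → Pred Carrier (c ⊔ ℓ)
    I j = Span (generator j) j

    π-power-suc : ∀ r → π-power (suc r) ≈ π-power r * π-power r ^ pred p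
    π-power-suc r = begin
      π ^ (p ℕ.* p ℕ.^ r ℕ.* t)   ≡⟨ ≡.cong (π ^_) (≡.trans (ℕₚ.*-assoc p (p ℕ.^ r) t) (ℕₚ.*-comm p _)) ⟩
      π ^ (p ℕ.^ r ℕ.* t ℕ.* p)   ≈⟨ ^-assocʳ π (p ℕ.^ r ℕ.* t) p ⟨
      π-power r ^ p               ≡⟨ ≡.cong (π-power r ^_) (ℕₚ.suc-pred p) ⟨
      π-power r ^ suc (pred p)    ∎

    generator-suc : ∀ {j r} → r ≤ j → generator (suc j) r ≈ π-power r * P ^ suc (j ∸ r)
    generator-suc r≤j = *-congˡ (reflexive (≡.cong (P ^_) (ℕₚ.+-∸-assoc 1 r≤j)))

    I⊆PairIdeal : ∀ {j r x} → r ≤ j → I j x → PairIdeal (P ^ suc (j ∸ r)) (π-power r) x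
    I⊆PairIdeal {j} {r} r≤j = Span-least PairIdeal-isIdeal generator∈PairIdeal
      where
      generator∈PairIdeal : ∀ {r′} → r′ ≤ j → PairIdeal (P ^ suc (j ∸ r)) (π-power r) (generator j r′)
      generator∈PairIdeal {r′} _ with ℕₚ.<-≤-connex r′ r
      ... | inj₁ r′<r = ∣⇒PairIdealˡ (∣-*ˡ (^-∣-^ P (ℕₚ.∸-monoʳ-< r′<r r≤j)) (π-power r′))
      ... | inj₂ r≤r′ =
        ∣⇒PairIdealʳ (∣-*ʳ (^-∣-^ π (ℕₚ.*-monoˡ-≤ t (ℕₚ.^-monoʳ-≤ p r≤r′))) (P ^ (j ∸ r′)))

    P*I⊆I : ∀ {j x} → I j x → I (suc j) (P * x)
    P*I⊆I {j} = Span-least (*-preimage-isIdeal P Span-isIdeal) P*generator∈I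
      where
      P*generator∈I : ∀ {r} → r ≤ j → I (suc j) (P * generator j r)
      P*generator∈I {r} r≤j = resp
        (trans (generator-suc r≤j)
               (solve 3 (λ B P F → B :* (P :* F) := P :* (B :* F)) refl (π-power r) P (P ^ (j ∸ r))))
        (Span-generator (ℕₚ.m≤n⇒m≤1+n r≤j))

    -- ε ≡ π-power r · β modulo P^(j−r+1), so ε^(p−1) · generator j r is a multiple of
    -- generator (suc j) r plus a multiple of π-power r ^ p · P^(j−r) = generator (suc j) (suc r).
    εᵖ⁻¹*I⊆I : ∀ {j ε x} → I j ε → I j x → I (suc j) (ε ^ pred p * x)
    εᵖ⁻¹*I⊆I {j} {ε} ε∈I = Span-least (*-preimage-isIdeal (ε ^ pred p) Span-isIdeal) εᵖ⁻¹*generator∈I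
      where
      εᵖ⁻¹*generator∈I : ∀ {r} → r ≤ j → I (suc j) (ε ^ pred p * generator j r)
      εᵖ⁻¹*generator∈I {r} r≤j with I⊆PairIdeal r≤j ε∈I
      ... | β , A∣ε-Bβ with ∣-trans A∣ε-Bβ (x-y∣xⁿ-yⁿ ε (π-power r * β) (pred p))
      ... | q , εᵖ⁻¹-[Bβ]ᵖ⁻¹≈Aq = resp (begin
          generator (suc j) r * (q * F) + generator (suc j) (suc r) * β ^ pred p
            ≈⟨ +-cong (*-congʳ (generator-suc r≤j)) (*-congʳ (*-congʳ (π-power-suc r))) ⟩
          B * A * (q * F) + B * B ^ pred p * F * β ^ pred p
            ≈⟨ solve 6 (λ A B F q Y b → B :* A :* (q :* F) :+ B :* Y :* F :* b := (A :* q :+ Y :* b) :* (B :* F))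
                 refl A B F q (B ^ pred p) (β ^ pred p) ⟩
          (A * q + B ^ pred p * β ^ pred p) * (B * F)
            ≈⟨ *-congʳ (+-cong εᵖ⁻¹-[Bβ]ᵖ⁻¹≈Aq (^-distrib-* B β (pred p))) ⟨
          (ε ^ pred p - (B * β) ^ pred p + (B * β) ^ pred p) * (B * F)
            ≈⟨ *-congʳ (solve 2 (λ e Z → e :- Z :+ Z := e) refl (ε ^ pred p) ((B * β) ^ pred p)) ⟩
          ε ^ pred p * (B * F) ∎)
        (add (multiple (ℕₚ.m≤n⇒m≤1+n r≤j) (q * F)) (multiple (s≤s r≤j) (β ^ pred p)))
        where
        A = P ^ suc (j ∸ r)
        B = π-power r
        F = P ^ (j ∸ r)

    [1+ε]ᵖ-1∈I : ∀ {j ε} → I j ε → I (suc j) ((1# + ε) ^ p - 1#)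
    [1+ε]ᵖ-1∈I {j} {ε} ε∈I with p*x∣[1+x]ᵖ-1-xᵖ p-prime ε
    ... | Q , [1+ε]ᵖ-1-εᵖ≈PεQ = resp (begin
        P * ε * Q + ε ^ pred p * ε
          ≈⟨ +-cong (sym [1+ε]ᵖ-1-εᵖ≈PεQ) (trans (*-comm _ ε) (^-congʳ ε (ℕₚ.suc-pred p))) ⟩
        (1# + ε) ^ p - 1# - ε ^ p + ε ^ p
          ≈⟨ solve 2 (λ E X → E :- :1 :- X :+ X := E :- :1) refl ((1# + ε) ^ p) (ε ^ p) ⟩
        (1# + ε) ^ p - 1# ∎)
      (add (IsIdeal.*-closed Span-isIdeal Q (P*I⊆I ε∈I)) (εᵖ⁻¹*I⊆I ε∈I ε∈I))

    [1+δ]ᵖʲ-1∈I : ∀ {δ} → π ^ t ∣ δ → ∀ j → I j ((1# + δ) ^ (p ℕ.^ j) - 1#)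
    [1+δ]ᵖʲ-1∈I {δ} (q , δ≈πᵗq) zero = resp (begin
        π ^ (1 ℕ.* t) * 1# * q   ≡⟨ ≡.cong (λ n → π ^ n * 1# * q) (ℕₚ.*-identityˡ t) ⟩
        π ^ t * 1# * q           ≈⟨ *-congʳ (*-identityʳ _) ⟩
        π ^ t * q                ≈⟨ δ≈πᵗq ⟨
        δ                        ≈⟨ solve 1 (λ δ → δ := (:1 :+ δ) :* :1 :- :1) refl δ ⟩
        (1# + δ) * 1# - 1#       ∎)
      (multiple z≤n q)
    [1+δ]ᵖʲ-1∈I {δ} π^t∣δ (suc j) = resp (begin
        (1# + (E - 1#)) ^ p - 1#          ≈⟨ +-congʳ (^-congˡ p (solve 1 (λ E → :1 :+ (E :- :1) := E) refl E)) ⟩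
        E ^ p - 1#                        ≈⟨ +-congʳ (^-assocʳ (1# + δ) (p ℕ.^ j) p) ⟩
        (1# + δ) ^ (p ℕ.^ j ℕ.* p) - 1#   ≡⟨ ≡.cong (λ n → (1# + δ) ^ n - 1#) (ℕₚ.*-comm (p ℕ.^ j) p) ⟩
        (1# + δ) ^ (p ℕ.^ suc j) - 1#     ∎)
      ([1+ε]ᵖ-1∈I ([1+δ]ᵖʲ-1∈I π^t∣δ j))
      where E = (1# + δ) ^ (p ℕ.^ j)

    ∣-*[[1+δ]ᵏ-1] : ∀ {δ} → π ^ t ∣ δ → ∀ {v k} → p ℕ.^ v ∣ℕ k → ∀ {d m} →
                    (∀ {r} → r ≤ v → d ∣ m * generator v r) → d ∣ m * ((1# + δ) ^ k - 1#)
    ∣-*[[1+δ]ᵏ-1] {δ} π^t∣δ {v} {k} (divides q k≡q*pᵛ) {d} {m} d∣m*generator =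
      ∣-trans (Span-least (*-preimage-isIdeal m (∣-isIdeal d)) d∣m*generator ([1+δ]ᵖʲ-1∈I π^t∣δ v))
              (∣-*-cong (∣-refl {m}) (∣-respʳ Eᵠ-1ᵠ≈[1+δ]ᵏ-1 (x-y∣xⁿ-yⁿ E 1# q)))
      where
      E = (1# + δ) ^ (p ℕ.^ v)
      Eᵠ-1ᵠ≈[1+δ]ᵏ-1 : E ^ q - 1# ^ q ≈ (1# + δ) ^ k - 1#
      Eᵠ-1ᵠ≈[1+δ]ᵏ-1 = begin
        E ^ q - 1# ^ q                    ≈⟨ +-cong (^-assocʳ (1# + δ) (p ℕ.^ v) q) (-‿cong (1^n≈1 q)) ⟩
        (1# + δ) ^ (p ℕ.^ v ℕ.* q) - 1#
          ≡⟨ ≡.cong (λ n → (1# + δ) ^ n - 1#) (≡.trans (ℕₚ.*-comm (p ℕ.^ v) q) (≡.sym k≡q*pᵛ)) ⟩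
        (1# + δ) ^ k - 1#                 ∎

  inverse-^ : ∀ {x b} → x * b ≈ 1# → ∀ m → b ^ m ≈ x * b ^ suc m
  inverse-^ {x} {b} xb≈1 m = begin
    b ^ m              ≈⟨ *-identityˡ _ ⟨
    1# * b ^ m         ≈⟨ *-congʳ xb≈1 ⟨
    x * b * b ^ m      ≈⟨ *-assoc x b (b ^ m) ⟩
    x * b ^ suc m      ∎

  inverse-shift : ∀ {a y b₀ b} → a * b₀ ≈ 1# → (a + y) * b ≈ 1# → b ≈ b₀ * (1# + y * - b)
  inverse-shift {a} {y} {b₀} {b} ab₀≈1 [a+y]b≈1 = begin
    b                               ≈⟨ *-identityˡ b ⟨
    1# * b                          ≈⟨ *-congʳ ab₀≈1 ⟨
    a * b₀ * b
      ≈⟨ solve 4 (λ a y b₀ b → a :* b₀ :* b := b₀ :* ((a :+ y) :* b :+ y :* :- b)) refl a y b₀ b ⟩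
    b₀ * ((a + y) * b + y * - b)    ≈⟨ *-congˡ (+-congʳ [a+y]b≈1) ⟩
    b₀ * (1# + y * - b)             ∎

  -- Replacing each 1 by the unit it equals turns the claim into a polynomial identity.
  inverse-shift₂ : ∀ {a y₁ y₂ b₀ b₁ b₂ b₁₂} →
    a * b₀ ≈ 1# → (a + y₁) * b₁ ≈ 1# → (a + y₂) * b₂ ≈ 1# → (a + y₁ + y₂) * b₁₂ ≈ 1# →
    b₁₂ ≈ b₀ * (1# + y₁ * - b₁) * (1# + y₂ * - b₂) * (1# + y₁ * y₂ * (b₀ * b₁₂))
  inverse-shift₂ {a} {y₁} {y₂} {b₀} {b₁} {b₂} {b₁₂} ab₀≈1 e₁≈1 e₂≈1 e₁₂≈1 = begin
    b₁₂
      ≈⟨ solve 1 (λ b → b := b :* :1 :* :1 :* :1 :* :1) refl b₁₂ ⟩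
    b₁₂ * 1# * 1# * 1# * 1#
      ≈⟨ *-cong (*-cong (*-cong (*-congˡ e₁≈1) e₂≈1) ab₀≈1) ab₀≈1 ⟨
    b₁₂ * e₁ * e₂ * (a * b₀) * (a * b₀)
      ≈⟨ solve 7 (λ a y₁ y₂ b₀ b₁ b₂ b₁₂ →
           b₁₂ :* ((a :+ y₁) :* b₁) :* ((a :+ y₂) :* b₂) :* (a :* b₀) :* (a :* b₀)
             := b₀ :* ((a :+ y₁) :* b₁ :+ y₁ :* :- b₁) :* ((a :+ y₂) :* b₂ :+ y₂ :* :- b₂)
                   :* (a :* b₀ :* ((a :+ y₁ :+ y₂) :* b₁₂) :+ y₁ :* y₂ :* (b₀ :* b₁₂)))
           refl a y₁ y₂ b₀ b₁ b₂ b₁₂ ⟩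
    b₀ * (e₁ + y₁ * - b₁) * (e₂ + y₂ * - b₂) * (a * b₀ * e₁₂ + y₁ * y₂ * (b₀ * b₁₂))
      ≈⟨ *-cong (*-cong (*-congˡ (+-congʳ e₁≈1)) (+-congʳ e₂≈1))
                (+-congʳ (trans (*-cong ab₀≈1 e₁₂≈1) (*-identityˡ 1#))) ⟩
    b₀ * (1# + y₁ * - b₁) * (1# + y₂ * - b₂) * (1# + y₁ * y₂ * (b₀ * b₁₂)) ∎
    where
    e₁ = (a + y₁) * b₁
    e₂ = (a + y₂) * b₂
    e₁₂ = (a + y₁ + y₂) * b₁₂

  inverse-power-second-difference :
    ∀ {π s m d a y₁ y₂ b₀ b₁ b₂ b₁₂} →
    (∀ {x δ} → π ^ s ∣ x → π ^ s ∣ δ → d ∣ x * ((1# + δ) ^ suc m - 1#)) →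
    (∀ {δ} → π ^ (s ℕ.+ s) ∣ δ → d ∣ (1# + δ) ^ suc m - 1#) →
    π ^ s ∣ y₁ → π ^ s ∣ y₂ →
    a * b₀ ≈ 1# → (a + y₁) * b₁ ≈ 1# → (a + y₂) * b₂ ≈ 1# → (a + y₁ + y₂) * b₁₂ ≈ 1# →
    d ∣ b₁₂ ^ m - b₁ ^ m - b₂ ^ m + b₀ ^ m
  inverse-power-second-difference {π} {s} {m} {d} {a} {y₁} {y₂} {b₀} {b₁} {b₂} {b₁₂}
    d∣x[[1+δ]ᵏ-1] d∣[1+δ]ᵏ-1 π^s∣y₁ π^s∣y₂ ab₀≈1 e₁≈1 e₂≈1 e₁₂≈1 =
    ∣-respʳ (sym expansion) (∣-*ˡ d∣E (b₀ ^ k))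
    where
    k = suc m
    δ₁ = y₁ * - b₁
    δ₂ = y₂ * - b₂
    δ₃ = y₁ * y₂ * (b₀ * b₁₂)
    X₁ = (1# + δ₁) ^ k
    X₂ = (1# + δ₂) ^ k
    X₃ = (1# + δ₃) ^ k
    E = a * ((X₁ - 1#) * (X₂ - 1#)) + (a + y₁ + y₂) * X₁ * X₂ * (X₃ - 1#)
        + X₁ * (y₁ * (X₂ - 1#)) + X₂ * (y₂ * (X₁ - 1#))

    π^s∣δ₁ : π ^ s ∣ δ₁
    π^s∣δ₁ = ∣-*ʳ π^s∣y₁ (- b₁)
    π^s∣δ₂ : π ^ s ∣ δ₂
    π^s∣δ₂ = ∣-*ʳ π^s∣y₂ (- b₂)
    π^2s∣δ₃ : π ^ (s ℕ.+ s) ∣ δ₃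
    π^2s∣δ₃ = ∣-respˡ (sym (^-homo-* π s s)) (∣-*ʳ (∣-*-cong π^s∣y₁ π^s∣y₂) (b₀ * b₁₂))

    d∣E : d ∣ E
    d∣E = ∣-+ (∣-+ (∣-+ (∣-*ˡ (d∣x[[1+δ]ᵏ-1] (∣-trans π^s∣δ₁ (δ∣[1+δ]ⁿ-1 δ₁ k)) π^s∣δ₂) a)
                        (∣-*ˡ (d∣[1+δ]ᵏ-1 π^2s∣δ₃) ((a + y₁ + y₂) * X₁ * X₂)))
                   (∣-*ˡ (d∣x[[1+δ]ᵏ-1] π^s∣y₁ π^s∣δ₂) X₁))
              (∣-*ˡ (d∣x[[1+δ]ᵏ-1] π^s∣y₂ π^s∣δ₁) X₂)

    b₁ᵏ≈ : b₁ ^ k ≈ b₀ ^ k * X₁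
    b₁ᵏ≈ = trans (^-congˡ k (inverse-shift ab₀≈1 e₁≈1)) (^-distrib-* b₀ (1# + δ₁) k)
    b₂ᵏ≈ : b₂ ^ k ≈ b₀ ^ k * X₂
    b₂ᵏ≈ = trans (^-congˡ k (inverse-shift ab₀≈1 e₂≈1)) (^-distrib-* b₀ (1# + δ₂) k)
    b₁₂ᵏ≈ : b₁₂ ^ k ≈ b₀ ^ k * X₁ * X₂ * X₃
    b₁₂ᵏ≈ = begin
      b₁₂ ^ k                                        ≈⟨ ^-congˡ k (inverse-shift₂ ab₀≈1 e₁≈1 e₂≈1 e₁₂≈1) ⟩
      (b₀ * (1# + δ₁) * (1# + δ₂) * (1# + δ₃)) ^ k   ≈⟨ ^-distrib-* _ (1# + δ₃) k ⟩
      (b₀ * (1# + δ₁) * (1# + δ₂)) ^ k * X₃          ≈⟨ *-congʳ (^-distrib-* _ (1# + δ₂) k) ⟩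
      (b₀ * (1# + δ₁)) ^ k * X₂ * X₃                 ≈⟨ *-congʳ (*-congʳ (^-distrib-* b₀ (1# + δ₁) k)) ⟩
      b₀ ^ k * X₁ * X₂ * X₃                          ∎

    expansion : b₁₂ ^ m - b₁ ^ m - b₂ ^ m + b₀ ^ m ≈ b₀ ^ k * E
    expansion = begin
      b₁₂ ^ m - b₁ ^ m - b₂ ^ m + b₀ ^ m
        ≈⟨ +-cong (+-cong (+-cong (inverse-^ e₁₂≈1 m) (-‿cong (inverse-^ e₁≈1 m))) (-‿cong (inverse-^ e₂≈1 m)))
                  (inverse-^ ab₀≈1 m) ⟩
      (a + y₁ + y₂) * b₁₂ ^ k - (a + y₁) * b₁ ^ k - (a + y₂) * b₂ ^ k + a * b₀ ^ k
        ≈⟨ +-congʳ (+-cong (+-cong (*-congˡ b₁₂ᵏ≈) (-‿cong (*-congˡ b₁ᵏ≈))) (-‿cong (*-congˡ b₂ᵏ≈))) ⟩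
      (a + y₁ + y₂) * (b₀ ^ k * X₁ * X₂ * X₃) - (a + y₁) * (b₀ ^ k * X₁) - (a + y₂) * (b₀ ^ k * X₂) + a * b₀ ^ k
        ≈⟨ solve 7 (λ a y₁ y₂ u X₁ X₂ X₃ →
             (a :+ y₁ :+ y₂) :* (u :* X₁ :* X₂ :* X₃) :- (a :+ y₁) :* (u :* X₁) :- (a :+ y₂) :* (u :* X₂) :+ a :* u
               := u :* (a :* ((X₁ :- :1) :* (X₂ :- :1)) :+ (a :+ y₁ :+ y₂) :* X₁ :* X₂ :* (X₃ :- :1)
                        :+ X₁ :* (y₁ :* (X₂ :- :1)) :+ X₂ :* (y₂ :* (X₁ :- :1))))
             refl a y₁ y₂ (b₀ ^ k) X₁ X₂ X₃ ⟩
      b₀ ^ k * E ∎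

  pow≡^ : ∀ x n → pow R x n ≡ x ^ n
  pow≡^ x zero    = ≡.refl
  pow≡^ x (suc n) = ≡.cong (x *_) (pow≡^ x n)

  fromℕ≡×1# : ∀ n → fromℕ R n ≡ n × 1#
  fromℕ≡×1# zero    = ≡.refl
  fromℕ≡×1# (suc n) = ≡.cong (1# +_) (fromℕ≡×1# n)

  x-0#≈x : ∀ x → x - 0# ≈ x
  x-0#≈x x = trans (+-congˡ -0#≈0#) (+-identityʳ x)

  pow-∣⇒^-∣ : ∀ x n {y} → _∣R_ R (pow R x n) y → x ^ n ∣ y
  pow-∣⇒^-∣ x n = ≡.subst (_∣ _) (pow≡^ x n)

  ^-∣⇒second-difference-≡0-mod : ∀ π n m b₀ b₁ b₂ b₁₂ →
    π ^ n ∣ b₁₂ ^ m - b₁ ^ m - b₂ ^ m + b₀ ^ m →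
    _≡_mod_ R (pow R b₁₂ m - pow R b₁ m - pow R b₂ m + pow R b₀ m) 0# (pow R π n)
  ^-∣⇒second-difference-≡0-mod π n m b₀ b₁ b₂ b₁₂ =
    ≡.subst₂ _∣_ (≡.sym (pow≡^ π n)) (≡.sym (≡.cong (_- 0#) pow≡^-second-difference))
    ∘ ∣-respʳ (sym (x-0#≈x _))
    where
    pow≡^-second-difference :
      pow R b₁₂ m - pow R b₁ m - pow R b₂ m + pow R b₀ m ≡ b₁₂ ^ m - b₁ ^ m - b₂ ^ m + b₀ ^ m
    pow≡^-second-difference =
      ≡.cong₂ _+_ (≡.cong₂ _-_ (≡.cong₂ _-_ (pow≡^ b₁₂ m) (pow≡^ b₁ m)) (pow≡^ b₂ m)) (pow≡^ b₀ m)

  module CProperty (π : Carrier) {p} (p-prime : Prime p) (n v s : ℕ) (c-property : CProp R π p n v s) where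
    private instance
      p≢0 : NonZero p
      p≢0 = prime⇒nonZero p-prime

    π^n∣π^[pʳ+1]s*pᵛ⁻ʳ : ∀ {r} → r ≤ v → π ^ n ∣ π ^ ((p ℕ.^ r ℕ.+ 1) ℕ.* s) * (p × 1#) ^ (v ∸ r)
    π^n∣π^[pʳ+1]s*pᵛ⁻ʳ {r} r≤v = pow-∣⇒^-∣ π n (∣-respʳ (begin
      pow R π e * fromℕ R (p ℕ.^ (v ∸ r)) - 0#   ≈⟨ x-0#≈x _ ⟩
      pow R π e * fromℕ R (p ℕ.^ (v ∸ r))        ≡⟨ ≡.cong₂ _*_ (pow≡^ π e) (fromℕ≡×1# (p ℕ.^ (v ∸ r))) ⟩
      π ^ e * (p ℕ.^ (v ∸ r)) × 1#               ≈⟨ *-congˡ (×1#-homo-^ p (v ∸ r)) ⟩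
      π ^ e * (p × 1#) ^ (v ∸ r)                 ∎) (c-property r r≤v))
      where e = (p ℕ.^ r ℕ.+ 1) ℕ.* s

    π^n∣π^e*pᵛ⁻ʳ : ∀ {r e} → r ≤ v → (p ℕ.^ r ℕ.+ 1) ℕ.* s ≤ e → π ^ n ∣ π ^ e * (p × 1#) ^ (v ∸ r)
    π^n∣π^e*pᵛ⁻ʳ r≤v ≤e = ∣-trans (π^n∣π^[pʳ+1]s*pᵛ⁻ʳ r≤v) (∣-*-cong (^-∣-^ π ≤e) ∣-refl)

    π^n∣x*[[1+δ]ᵏ-1] : ∀ {k} → p ℕ.^ v ∣ℕ k → ∀ {x δ} → π ^ s ∣ x → π ^ s ∣ δ →
                       π ^ n ∣ x * ((1# + δ) ^ k - 1#)
    π^n∣x*[[1+δ]ᵏ-1] pᵛ∣k {x} (q , x≈πˢq) π^s∣δ = ∣-*[[1+δ]ᵏ-1] π^s∣δ pᵛ∣k π^n∣x*generator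
      where
      open PrimePowerLifting π p-prime s
      π^n∣x*generator : ∀ {r} → r ≤ v → π ^ n ∣ x * generator v r
      π^n∣x*generator {r} r≤v = ∣-respʳ (sym (begin
          x * (π-power r * F)                 ≈⟨ *-congʳ x≈πˢq ⟩
          π ^ s * q * (π-power r * F)
            ≈⟨ solve 4 (λ A q B F → A :* q :* (B :* F) := A :* B :* F :* q) refl (π ^ s) q (π-power r) F ⟩
          π ^ s * π-power r * F * q
            ≈⟨ *-congʳ (*-congʳ (^-homo-* π s (p ℕ.^ r ℕ.* s))) ⟨
          π ^ (s ℕ.+ p ℕ.^ r ℕ.* s) * F * q
            ∎))
        (∣-*ʳ (π^n∣π^e*pᵛ⁻ʳ r≤v (ℕₚ.≤-reflexive ([m+1]*n≡n+m*n (p ℕ.^ r) s))) q)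
        where F = (p × 1#) ^ (v ∸ r)

    π^n∣[1+δ]ᵏ-1 : ∀ {k} → p ℕ.^ v ∣ℕ k → ∀ {δ} → π ^ (s ℕ.+ s) ∣ δ → π ^ n ∣ (1# + δ) ^ k - 1#
    π^n∣[1+δ]ᵏ-1 pᵛ∣k π^2s∣δ = ∣-respʳ (*-identityˡ _) (∣-*[[1+δ]ᵏ-1] π^2s∣δ pᵛ∣k
        (λ {r} r≤v → ∣-respʳ (sym (*-identityˡ _))
                       (π^n∣π^e*pᵛ⁻ʳ r≤v ([m+1]*n≤m*[n+n] (p ℕ.^ r) s {{ℕₚ.m^n≢0 p r}}))))
      where open PrimePowerLifting π p-prime (s ℕ.+ s)

lemma2p4 : ∀ {c ℓ} (R : CommutativeRing c ℓ) → let open CommutativeRing R in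
    (π : Carrier) (p n k : ℕ) →
    IsDVR R π → FiniteResidueField R π → ResidueChar R π p →
    n ≥ 1 → k ≥ 1 →
    (v : ℕ) → IsPadicVal p k v →
    (s : ℕ) → IsC R π p n v s →
    (a y₁ y₂ : Carrier) →
    _∣R_ R (pow R π s) y₁ → _∣R_ R (pow R π s) y₂ →
    (b₀ b₁ b₂ b₁₂ : Carrier) →
    a * b₀ ≈ 1# → (a + y₁) * b₁ ≈ 1# → (a + y₂) * b₂ ≈ 1# → (a + y₁ + y₂) * b₁₂ ≈ 1# →
    _≡_mod_ R (pow R b₁₂ (k ∸ 1) - pow R b₁ (k ∸ 1) - pow R b₂ (k ∸ 1) + pow R b₀ (k ∸ 1))
      0# (pow R π n)
lemma2p4 _ _ _ _ zero _ _ _ _ ()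
lemma2p4 R π p n (suc m) _ _ (p-prime , _) _ _ v (pᵛ∣k , _) s (c-property , _) a y₁ y₂ π^s∣y₁ π^s∣y₂
         b₀ b₁ b₂ b₁₂ ab₀≈1 e₁≈1 e₂≈1 e₁₂≈1 =
  ^-∣⇒second-difference-≡0-mod R π n m b₀ b₁ b₂ b₁₂
    (inverse-power-second-difference R {π} {s} {m}
      (π^n∣x*[[1+δ]ᵏ-1] pᵛ∣k) (π^n∣[1+δ]ᵏ-1 pᵛ∣k)
      (pow-∣⇒^-∣ R π s π^s∣y₁) (pow-∣⇒^-∣ R π s π^s∣y₂) ab₀≈1 e₁≈1 e₂≈1 e₁₂≈1)
  where open CProperty R π p-prime n v s c-property
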